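{- There exists an infinite cubefree binary word $\mathbf{w}$ containing exponentially many distinct squares of length $n$; that is, there is a real constant $c>1$ such that for infinitely many positive integers $n$, the number of distinct factors of $\mathbf{w}$ of length $n$ that are squares is at least $c^n$.
   Context: A square is a non-empty word of the form $xx$; a cube is a non-empty word of the form $xxx$. A (finite or infinite) word is cubefree if none of its factors (contiguous finite subwords) is a cube. A binary word is a word over a two-letter alphabet $\{0,1\}$. -}

module Defs where

open import Data.Bool using (Bool)
open import Data.Nat using (ℕ; _+_; _*_; _^_; _≤_; _<_)
open import Data.List using (List; []; _++_; map; upTo; length)
open import Data.List.Relation.Unary.All using (All)
open import Data.List.Relation.Unary.Unique.Propositional using (Unique)
open import Data.Product using (Σ; ∃; ∃-syntax; _×_)
open import Relation.Binary.PropositionalEquality using (_≡_; _≢_)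
open import Relation.Nullary using (¬_)

Word : Set
Word = List Bool

InfWord : Set
InfWord = ℕ → Bool

factorAt : InfWord → ℕ → ℕ → Word
factorAt w i n = map (λ j → w (i + j)) (upTo n)

IsFactor : InfWord → Word → Set
IsFactor w u = ∃[ i ] factorAt w i (length u) ≡ u

IsSquare : Word → Set
IsSquare u = ∃[ x ] (x ≢ [] × u ≡ x ++ x)

IsCube : Word → Set
IsCube u = ∃[ x ] (x ≢ [] × u ≡ x ++ x ++ x)

CubeFree : InfWord → Set
CubeFree w = ∀ u → IsFactor w u → ¬ IsCube u

-- "w has at least k distinct square factors of length n":
-- there is a duplicate-free list of k such words
SquareFactorsOfLength : InfWord → ℕ → List Word → Set
SquareFactorsOfLength w n L =
  Unique L × All (λ u → length u ≡ n × IsSquare u × IsFactor w u) L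

-- The word is a "block word": block number K (nine letters) is the header 100110
-- followed by a three-letter code of the pair (tm K, f K), where tm is the Thue–Morse
-- word and f : ℕ → Bool is arbitrary.  Every block word is cubefree: a cube of period
-- at most 6 would be visible inside three consecutive blocks, which an exhaustive check
-- over the 64 possible windows excludes; for a longer period the header forces the
-- period to be a multiple 9q of the block length, and the middle code letters then form
-- a cube of period q in the cubefree Thue–Morse word.
--
-- The free letters are then chosen by a selector reading a level m, a digit position r
-- and a number x off the block index, such that for each x < 2 ^ 2 ^ m the 2 ^ (m + 1)
-- blocks from 2 ^ m (4 I + 1) on (I = 2 ^ 2 ^ (m + 1) + x) form a square spelling out
-- the binary digits of x.  This gives 2 ^ 2 ^ m distinct squares of length n = 18 · 2 ^ m,
-- and 2 ^ (n / 18) · 26 ^ n ≥ 27 ^ n.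

module Submission where

open import Defs
open import Data.Bool using (Bool; true; false; not; _xor_; _∧_; _∨_; T; if_then_else_)
open import Data.Bool.Properties using (xor-assoc; xor-comm; not-¬; T-∧; T-∨)
open import Data.Empty using (⊥; ⊥-elim)
open import Data.List using (List; []; _∷_; _++_; length; applyUpTo)
open import Data.List.Properties using (length-++; map-upTo; length-applyUpTo; ∷-injectiveˡ; ∷-injectiveʳ)
open import Data.List.Relation.Unary.All.Properties using () renaming (applyUpTo⁺₁ to all-applyUpTo)
open import Data.List.Relation.Unary.Unique.Propositional.Properties using () renaming (applyUpTo⁺₁ to unique-applyUpTo)
open import Data.Nat using (ℕ; zero; suc; _+_; _*_; _^_; _≤_; _<_; _∸_; z≤n; s≤s; ⌊_/2⌋; _/_; _%_; _≤?_; NonZero)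
open import Data.Nat.DivMod using (m≡m%n+[m/n]*n; [m+kn]%n≡m%n; m<n⇒m%n≡m; +-distrib-/; m*n/n≡m; m<n⇒m/n≡0; m%n<n; m*n%n≡0)
open import Data.Nat.Divisibility using (_∣_; divides; ∣m+n∣m⇒∣n)
open import Data.Nat.Induction using (<-rec)
open import Data.Nat.Logarithm using (⌊log₂_⌋; ⌊log₂⌋-mono-≤; ⌊log₂⌊n/2⌋⌋≡⌊log₂n⌋∸1)
open import Data.Nat.Properties
open import Algebra.Properties.CommutativeSemigroup +-commutativeSemigroup using (xy∙z≈xz∙y) renaming (interchange to +-interchange)
open import Algebra.Properties.CommutativeSemigroup *-commutativeSemigroup using () renaming (interchange to *-interchange)
open import Data.Nat.Tactic.RingSolver using (solve-∀)
open import Data.Product using (∃-syntax; _×_; _,_; proj₁; proj₂)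
open import Data.Sum using (_⊎_; inj₁; inj₂)
open import Data.Unit using (tt)
open import Function.Bundles using (Equivalence)
open import Relation.Binary.PropositionalEquality
open import Relation.Nullary using (¬_; yes; no)
open import Relation.Nullary.Decidable using (toWitness)

odd : ℕ → Bool
odd 0 = false
odd 1 = true
odd (suc (suc n)) = odd n

even-or-odd : ∀ n → (∃[ h ] n ≡ h + h) ⊎ (∃[ h ] n ≡ suc (h + h))
even-or-odd zero = inj₁ (0 , refl)
even-or-odd (suc zero) = inj₂ (0 , refl)
even-or-odd (suc (suc n)) with even-or-odd n
... | inj₁ (h , refl) = inj₁ (suc h , cong suc (sym (+-suc h h)))
... | inj₂ (h , refl) = inj₂ (suc h , cong (λ x → suc (suc x)) (sym (+-suc h h)))

half-double+ : ∀ a y → ⌊ a + a + y /2⌋ ≡ a + ⌊ y /2⌋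
half-double+ zero y = refl
half-double+ (suc a) y rewrite +-suc a a = cong suc (half-double+ a y)

odd-double+ : ∀ a y → odd (a + a + y) ≡ odd y
odd-double+ zero y = refl
odd-double+ (suc a) y rewrite +-suc a a = odd-double+ a y

-- The same with the even addend written 2 * a, as it occurs in 2 ^ (1 + m) * z.
half-shift : ∀ a r → ⌊ 2 * a + r /2⌋ ≡ a + ⌊ r /2⌋
half-shift a r rewrite +-identityʳ a = half-double+ a r

odd-shift : ∀ a r → odd (2 * a + r) ≡ odd r
odd-shift a r rewrite +-identityʳ a = odd-double+ a r

half-double : ∀ a → ⌊ a + a /2⌋ ≡ a
half-double a = sym (n≡⌊n+n/2⌋ a)

half-double+1 : ∀ a → ⌊ suc (a + a) /2⌋ ≡ a
half-double+1 zero = refl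
half-double+1 (suc a) rewrite +-suc a a = cong suc (half-double+1 a)

odd-double : ∀ a → odd (a + a) ≡ false
odd-double zero = refl
odd-double (suc a) rewrite +-suc a a = odd-double a

odd-double+1 : ∀ a → odd (suc (a + a)) ≡ true
odd-double+1 zero = refl
odd-double+1 (suc a) rewrite +-suc a a = odd-double+1 a

half-< : ∀ x P → x < 2 * P → ⌊ x /2⌋ < P
half-< x P x<2P = below-double x P (subst (x <_) (cong (P +_) (+-identityʳ P)) x<2P)
  where
  below-double : ∀ x P → x < P + P → ⌊ x /2⌋ < P
  below-double zero (suc P) _ = s≤s z≤n
  below-double (suc zero) (suc P) _ = s≤s z≤n
  below-double (suc (suc x)) (suc P) (s≤s lt) rewrite +-suc P P = s≤s (below-double x P (≤-pred lt))

bitValue : Bool → ℕ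
bitValue true = 1
bitValue false = 0

half-reconstruct : ∀ x → x ≡ bitValue (odd x) + (⌊ x /2⌋ + ⌊ x /2⌋)
half-reconstruct x with even-or-odd x
... | inj₁ (h , refl) rewrite odd-double h | half-double h = refl
... | inj₂ (h , refl) rewrite odd-double+1 h | half-double+1 h = refl

-- Binary digits: shiftR r x = ⌊ x / 2 ^ r ⌋, bit r x is its r-th binary digit,
-- and lowBits m x = x mod 2 ^ m is rebuilt from the m lowest digits.
shiftR : ℕ → ℕ → ℕ
shiftR zero x = x
shiftR (suc r) x = shiftR r ⌊ x /2⌋

bit : ℕ → ℕ → Bool
bit r x = odd (shiftR r x)

lowBits : ℕ → ℕ → ℕ
lowBits zero x = 0
lowBits (suc m) x = bitValue (odd x) + (lowBits m ⌊ x /2⌋ + lowBits m ⌊ x /2⌋)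

shiftR-split : ∀ m z r → r < 2 ^ m → shiftR m (2 ^ m * z + r) ≡ z
shiftR-split zero z zero _ = trans (+-identityʳ (z + 0)) (+-identityʳ z)
shiftR-split zero z (suc r) (s≤s ())
shiftR-split (suc m) z r r< = begin
  shiftR m ⌊ 2 * 2 ^ m * z + r /2⌋   ≡⟨ cong (λ n → shiftR m ⌊ n + r /2⌋) (*-assoc 2 (2 ^ m) z) ⟩
  shiftR m ⌊ 2 * (2 ^ m * z) + r /2⌋ ≡⟨ cong (shiftR m) (half-shift (2 ^ m * z) r) ⟩
  shiftR m (2 ^ m * z + ⌊ r /2⌋)     ≡⟨ shiftR-split m z ⌊ r /2⌋ (half-< r (2 ^ m) r<) ⟩
  z                                  ∎
  where open ≡-Reasoning

lowBits-split : ∀ m z r → r < 2 ^ m → lowBits m (2 ^ m * z + r) ≡ r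
lowBits-split zero z zero _ = refl
lowBits-split zero z (suc r) (s≤s ())
lowBits-split (suc m) z r r< = begin
  lowBits (suc m) (2 * 2 ^ m * z + r)
    ≡⟨ cong (λ n → lowBits (suc m) (n + r)) (*-assoc 2 (2 ^ m) z) ⟩
  bitValue (odd N) + (lowBits m ⌊ N /2⌋ + lowBits m ⌊ N /2⌋)
    ≡⟨ cong₂ (λ b h → bitValue b + (lowBits m h + lowBits m h)) (odd-shift (2 ^ m * z) r) (half-shift (2 ^ m * z) r) ⟩
  bitValue (odd r) + (lowBits m (2 ^ m * z + ⌊ r /2⌋) + lowBits m (2 ^ m * z + ⌊ r /2⌋))
    ≡⟨ cong (λ l → bitValue (odd r) + (l + l)) (lowBits-split m z ⌊ r /2⌋ (half-< r (2 ^ m) r<)) ⟩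
  bitValue (odd r) + (⌊ r /2⌋ + ⌊ r /2⌋)
    ≡⟨ sym (half-reconstruct r) ⟩
  r ∎
  where
  open ≡-Reasoning
  N : ℕ
  N = 2 * (2 ^ m * z) + r

bits-injective : ∀ Q x y → x < 2 ^ Q → y < 2 ^ Q → (∀ r → r < Q → bit r x ≡ bit r y) → x ≡ y
bits-injective zero zero zero _ _ _ = refl
bits-injective zero (suc x) _ (s≤s ()) _ _
bits-injective zero zero (suc y) _ (s≤s ()) _
bits-injective (suc Q) x y x< y< same = begin
  x                                          ≡⟨ half-reconstruct x ⟩
  bitValue (odd x) + (⌊ x /2⌋ + ⌊ x /2⌋)   ≡⟨ cong₂ (λ b h → bitValue b + (h + h)) (same 0 (s≤s z≤n)) halves ⟩
  bitValue (odd y) + (⌊ y /2⌋ + ⌊ y /2⌋)   ≡⟨ sym (half-reconstruct y) ⟩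
  y                                          ∎
  where
  open ≡-Reasoning
  halves : ⌊ x /2⌋ ≡ ⌊ y /2⌋
  halves = bits-injective Q ⌊ x /2⌋ ⌊ y /2⌋ (half-< x (2 ^ Q) x<) (half-< y (2 ^ Q) y<)
                          (λ r r<Q → same (suc r) (s≤s r<Q))

bit-add-high : ∀ r S x → r < S → bit r (2 ^ S + x) ≡ bit r x
bit-add-high zero (suc S) x _ = odd-shift (2 ^ S) x
bit-add-high (suc r) (suc S) x (s≤s r<S) =
  trans (cong (λ n → bit r n) (half-shift (2 ^ S) x)) (bit-add-high r S ⌊ x /2⌋ r<S)

shiftR-zero : ∀ e → shiftR e 0 ≡ 0
shiftR-zero zero = refl
shiftR-zero (suc e) = shiftR-zero e

log-from-shiftR : ∀ e K → shiftR e K ≡ 1 → ⌊log₂ K ⌋ ≡ e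
log-from-shiftR zero K refl = refl
log-from-shiftR (suc e) zero s with () ← trans (sym (shiftR-zero e)) s
log-from-shiftR (suc e) (suc zero) s with () ← trans (sym (shiftR-zero e)) s
log-from-shiftR (suc e) K@(suc (suc n)) s = begin
  ⌊log₂ K ⌋           ≡⟨ sym (m∸n+n≡m 1≤log) ⟩
  ⌊log₂ K ⌋ ∸ 1 + 1   ≡⟨ cong (_+ 1) (sym (⌊log₂⌊n/2⌋⌋≡⌊log₂n⌋∸1 K)) ⟩
  ⌊log₂ ⌊ K /2⌋ ⌋ + 1 ≡⟨ cong (_+ 1) (log-from-shiftR e ⌊ K /2⌋ s) ⟩
  e + 1               ≡⟨ +-comm e 1 ⟩
  suc e               ∎
  where
  open ≡-Reasoning
  1≤log : 1 ≤ ⌊log₂ K ⌋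
  1≤log = ⌊log₂⌋-mono-≤ {2} {K} (s≤s (s≤s z≤n))

applyUpTo-++ : ∀ {A : Set} (f : ℕ → A) a b → applyUpTo f (a + b) ≡ applyUpTo f a ++ applyUpTo (λ j → f (a + j)) b
applyUpTo-++ f zero b = refl
applyUpTo-++ f (suc a) b = cong (f 0 ∷_) (applyUpTo-++ (λ j → f (suc j)) a b)

applyUpTo-cong : ∀ {A : Set} (f g : ℕ → A) n → (∀ j → j < n → f j ≡ g j) → applyUpTo f n ≡ applyUpTo g n
applyUpTo-cong f g zero _ = refl
applyUpTo-cong f g (suc n) eq =
  cong₂ _∷_ (eq 0 (s≤s z≤n)) (applyUpTo-cong (λ j → f (suc j)) (λ j → g (suc j)) n (λ j j<n → eq (suc j) (s≤s j<n)))

applyUpTo-pointwise : ∀ {A : Set} (f g : ℕ → A) n → applyUpTo f n ≡ applyUpTo g n → ∀ j → j < n → f j ≡ g j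
applyUpTo-pointwise f g (suc n) eq zero _ = ∷-injectiveˡ eq
applyUpTo-pointwise f g (suc n) eq (suc j) (s≤s j<n) =
  applyUpTo-pointwise (λ j → f (suc j)) (λ j → g (suc j)) n (∷-injectiveʳ eq) j j<n

++-cancel-length : ∀ {A : Set} (a b c d : List A) → length a ≡ length c → a ++ b ≡ c ++ d → a ≡ c × b ≡ d
++-cancel-length [] b [] d _ eq = refl , eq
++-cancel-length (x ∷ a) b (y ∷ c) d len eq with ++-cancel-length a b c d (suc-injective len) (∷-injectiveʳ eq)
... | refl , refl = cong (_∷ a) (∷-injectiveˡ eq) , refl

factorAt-applyUpTo : ∀ w i n → factorAt w i n ≡ applyUpTo (λ j → w (i + j)) n
factorAt-applyUpTo w i n = map-upTo (λ j → w (i + j)) n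

length-factorAt : ∀ w i n → length (factorAt w i n) ≡ n
length-factorAt w i n = trans (cong length (factorAt-applyUpTo w i n)) (length-applyUpTo _ n)

factorAt-split : ∀ w i a b → factorAt w i (a + b) ≡ factorAt w i a ++ factorAt w (i + a) b
factorAt-split w i a b = begin
  factorAt w i (a + b)
    ≡⟨ factorAt-applyUpTo w i (a + b) ⟩
  applyUpTo (λ j → w (i + j)) (a + b)
    ≡⟨ applyUpTo-++ _ a b ⟩
  applyUpTo (λ j → w (i + j)) a ++ applyUpTo (λ j → w (i + (a + j))) b
    ≡⟨ cong₂ _++_ (sym (factorAt-applyUpTo w i a))
         (trans (applyUpTo-cong _ _ b (λ j _ → cong w (sym (+-assoc i a j)))) (sym (factorAt-applyUpTo w (i + a) b))) ⟩
  factorAt w i a ++ factorAt w (i + a) b ∎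
  where open ≡-Reasoning

factorAt-ext : ∀ w i k n → (∀ j → j < n → w (i + j) ≡ w (k + j)) → factorAt w i n ≡ factorAt w k n
factorAt-ext w i k n eq = begin
  factorAt w i n                 ≡⟨ factorAt-applyUpTo w i n ⟩
  applyUpTo (λ j → w (i + j)) n  ≡⟨ applyUpTo-cong _ _ n eq ⟩
  applyUpTo (λ j → w (k + j)) n  ≡⟨ sym (factorAt-applyUpTo w k n) ⟩
  factorAt w k n                 ∎
  where open ≡-Reasoning

factorAt-pointwise : ∀ w i k n → factorAt w i n ≡ factorAt w k n → ∀ j → j < n → w (i + j) ≡ w (k + j)
factorAt-pointwise w i k n eq = applyUpTo-pointwise _ _ n
  (trans (sym (factorAt-applyUpTo w i n)) (trans eq (factorAt-applyUpTo w k n)))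

-- Periodic w p i len: the len letters from position i repeat after p positions.
-- A cube of period p at i is a periodic stretch of length 2p.
Periodic : InfWord → ℕ → ℕ → ℕ → Set
Periodic w p i len = ∀ j → j < len → w (i + j) ≡ w (i + j + p)

HasCube : InfWord → ℕ → ℕ → Set
HasCube w p i = Periodic w p i (p + p)

non-empty-length : ∀ {A : Set} (x : List A) → x ≢ [] → 1 ≤ length x
non-empty-length [] x≢[] = ⊥-elim (x≢[] refl)
non-empty-length (_ ∷ _) _ = s≤s z≤n

cube-factor-periodic : ∀ w u → IsFactor w u → IsCube u → ∃[ p ] ∃[ i ] (1 ≤ p × HasCube w p i)
cube-factor-periodic w u (i , fac) (x , x≢[] , refl) = p , i , non-empty-length x x≢[] , periodic
  where
  p : ℕ
  p = length x
  third₁ third₂ third₃ : Word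
  third₁ = factorAt w i p
  third₂ = factorAt w (i + p) p
  third₃ = factorAt w (i + p + p) p
  whole : third₁ ++ (third₂ ++ third₃) ≡ x ++ (x ++ x)
  whole = begin
    third₁ ++ (third₂ ++ third₃)        ≡⟨ cong (third₁ ++_) (sym (factorAt-split w (i + p) p p)) ⟩
    third₁ ++ factorAt w (i + p) (p + p) ≡⟨ sym (factorAt-split w i p (p + p)) ⟩
    factorAt w i (p + (p + p))          ≡⟨ cong (factorAt w i) (sym (trans (length-++ x {x ++ x}) (cong (p +_) (length-++ x {x})))) ⟩
    factorAt w i (length (x ++ x ++ x)) ≡⟨ fac ⟩
    x ++ (x ++ x)                       ∎
    where open ≡-Reasoning
  first : third₁ ≡ x
  first = proj₁ (++-cancel-length third₁ (third₂ ++ third₃) x (x ++ x) (length-factorAt w i p) whole)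
  second×third : third₂ ≡ x × third₃ ≡ x
  second×third = ++-cancel-length third₂ third₃ x x (length-factorAt w (i + p) p)
                   (proj₂ (++-cancel-length third₁ (third₂ ++ third₃) x (x ++ x) (length-factorAt w i p) whole))
  shifted : factorAt w i (p + p) ≡ factorAt w (i + p) (p + p)
  shifted = begin
    factorAt w i (p + p)        ≡⟨ factorAt-split w i p p ⟩
    third₁ ++ third₂            ≡⟨ cong₂ _++_ (trans first (sym (proj₁ second×third)))
                                              (trans (proj₁ second×third) (sym (proj₂ second×third))) ⟩
    third₂ ++ third₃            ≡⟨ sym (factorAt-split w (i + p) p p) ⟩
    factorAt w (i + p) (p + p)  ∎
    where open ≡-Reasoning
  periodic : HasCube w p i
  periodic j j<2p = trans (factorAt-pointwise w i (i + p) (p + p) shifted j j<2p) (cong w (xy∙z≈xz∙y i p j))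

cubeFree-from-periods : ∀ w → (∀ p i → 1 ≤ p → ¬ HasCube w p i) → CubeFree w
cubeFree-from-periods w noCube u fac cube with cube-factor-periodic w u fac cube
... | p , i , 1≤p , hasCube = noCube p i 1≤p hasCube

periodic-square : ∀ w h i → 1 ≤ h → Periodic w h i h → IsSquare (factorAt w i (h + h))
periodic-square w h i 1≤h periodic = factorAt w i h , nonEmpty , square
  where
  nonEmpty : factorAt w i h ≢ []
  nonEmpty eq = <⇒≢ 1≤h (sym (trans (sym (length-factorAt w i h)) (cong length eq)))
  square : factorAt w i (h + h) ≡ factorAt w i h ++ factorAt w i h
  square = trans (factorAt-split w i h h)
                 (cong (factorAt w i h ++_) (sym (factorAt-ext w i (i + h) h
                   (λ j j<h → trans (periodic j j<h) (cong w (xy∙z≈xz∙y i j h))))))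

-- The Thue–Morse word: tm n is the parity of the binary digit sum of n.  It is
-- computed with fuel; fuel f ≥ n suffices, since each step halves the argument.
tmFuel : ℕ → ℕ → Bool
tmFuel zero n = false
tmFuel (suc f) n = odd n xor tmFuel f ⌊ n /2⌋

tm : InfWord
tm n = tmFuel n n

tmFuel-zero : ∀ f → tmFuel f 0 ≡ false
tmFuel-zero zero = refl
tmFuel-zero (suc f) = tmFuel-zero f

half-≤-pred : ∀ {n f} → n ≤ suc f → ⌊ n /2⌋ ≤ f
half-≤-pred {zero} _ = z≤n
half-≤-pred {suc n} (s≤s n≤f) = ≤-trans (≤-pred (⌊n/2⌋<n n)) n≤f

tmFuel-enough : ∀ f g n → n ≤ f → n ≤ g → tmFuel f n ≡ tmFuel g n
tmFuel-enough zero g zero _ _ = sym (tmFuel-zero g)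
tmFuel-enough (suc f) zero zero _ _ = tmFuel-zero (suc f)
tmFuel-enough (suc f) (suc g) n n≤f n≤g =
  cong (odd n xor_) (tmFuel-enough f g ⌊ n /2⌋ (half-≤-pred n≤f) (half-≤-pred n≤g))

tm-unfold : ∀ n → tm n ≡ odd n xor tm ⌊ n /2⌋
tm-unfold zero = refl
tm-unfold (suc n) = cong (odd (suc n) xor_) (tmFuel-enough n ⌊ suc n /2⌋ ⌊ suc n /2⌋ (≤-pred (⌊n/2⌋<n n)) ≤-refl)

tm-even : ∀ a → tm (a + a) ≡ tm a
tm-even a = trans (tm-unfold (a + a)) (cong₂ _xor_ (odd-double a) (cong tm (half-double a)))

tm-odd : ∀ a → tm (suc (a + a)) ≡ not (tm a)
tm-odd a = trans (tm-unfold (suc (a + a))) (cong₂ _xor_ (odd-double+1 a) (cong tm (half-double+1 a)))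

tm-differs-from-even : ∀ n a → n ≡ a + a → tm n ≢ tm (suc n)
tm-differs-from-even n a refl eq = not-¬ refl (trans (sym (tm-even a)) (trans eq (tm-odd a)))

xor-swap : ∀ x y z → x xor (y xor z) ≡ y xor (x xor z)
xor-swap x y z = trans (sym (xor-assoc x y z)) (trans (cong (_xor z) (xor-comm x y)) (xor-assoc y x z))

-- Concatenation of binary expansions: tm (2^m a + r) = tm a xor tm r for r < 2^m.
tm-split : ∀ m a r → r < 2 ^ m → tm (2 ^ m * a + r) ≡ tm a xor tm r
tm-split zero a zero _ = trans (cong tm (trans (+-identityʳ (a + 0)) (+-identityʳ a))) (sym (xor-comm (tm a) false))
tm-split zero a (suc r) (s≤s ())
tm-split (suc m) a r r< = begin
  tm (2 * 2 ^ m * a + r)                       ≡⟨ cong (λ n → tm (n + r)) (*-assoc 2 (2 ^ m) a) ⟩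
  tm (N + r)                                   ≡⟨ tm-unfold (N + r) ⟩
  odd (N + r) xor tm ⌊ N + r /2⌋               ≡⟨ cong₂ _xor_ (odd-shift (2 ^ m * a) r) (cong tm (half-shift (2 ^ m * a) r)) ⟩
  odd r xor tm (2 ^ m * a + ⌊ r /2⌋)           ≡⟨ cong (odd r xor_) (tm-split m a ⌊ r /2⌋ (half-< r (2 ^ m) r<)) ⟩
  odd r xor (tm a xor tm ⌊ r /2⌋)              ≡⟨ xor-swap (odd r) (tm a) (tm ⌊ r /2⌋) ⟩
  tm a xor (odd r xor tm ⌊ r /2⌋)              ≡⟨ cong (tm a xor_) (sym (tm-unfold r)) ⟩
  tm a xor tm r                                ∎
  where
  open ≡-Reasoning
  N : ℕ
  N = 2 * (2 ^ m * a)

-- tm (4a + 1) = tm (4a + 2); scaled by 2 ^ m this gives two equal Thue–Morse stretches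
-- of length 2 ^ m side by side.
tm-twin : ∀ m a r → r < 2 ^ m → tm (2 ^ m * (4 * a + 1) + r) ≡ tm (2 ^ m * (4 * a + 2) + r)
tm-twin m a r r< = begin
  tm (2 ^ m * (4 * a + 1) + r)  ≡⟨ tm-split m (4 * a + 1) r r< ⟩
  tm (4 * a + 1) xor tm r       ≡⟨ cong (_xor tm r) twin ⟩
  tm (4 * a + 2) xor tm r       ≡⟨ sym (tm-split m (4 * a + 2) r r<) ⟩
  tm (2 ^ m * (4 * a + 2) + r)  ∎
  where
  open ≡-Reasoning
  twin : tm (4 * a + 1) ≡ tm (4 * a + 2)
  twin = begin
    tm (4 * a + 1)              ≡⟨ cong tm (4a+1 a) ⟩
    tm (suc ((a + a) + (a + a))) ≡⟨ tm-odd (a + a) ⟩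
    not (tm (a + a))            ≡⟨ cong not (tm-even a) ⟩
    not (tm a)                  ≡⟨ sym (tm-odd a) ⟩
    tm (suc (a + a))            ≡⟨ sym (tm-even (suc (a + a))) ⟩
    tm (suc (a + a) + suc (a + a)) ≡⟨ cong tm (sym (4a+2 a)) ⟩
    tm (4 * a + 2)              ∎
    where
    4a+1 : ∀ a → 4 * a + 1 ≡ suc ((a + a) + (a + a))
    4a+1 = solve-∀
    4a+2 : ∀ a → 4 * a + 2 ≡ suc (a + a) + suc (a + a)
    4a+2 = solve-∀

bool-alternation : ∀ {a b c : Bool} → a ≢ b → b ≢ c → a ≡ c
bool-alternation {false} {false} a≢b _ = ⊥-elim (a≢b refl)
bool-alternation {false} {true} {false} _ _ = refl
bool-alternation {false} {true} {true} _ b≢c = ⊥-elim (b≢c refl)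
bool-alternation {true} {false} {false} _ b≢c = ⊥-elim (b≢c refl)
bool-alternation {true} {false} {true} _ _ = refl
bool-alternation {true} {true} a≢b _ = ⊥-elim (a≢b refl)

-- tm has no cube of period 1, i.e. no factor aaa: of two consecutive positions
-- i, i + 1 one is even, and there the letter changes.
tm-no-period-1 : ∀ i → ¬ HasCube tm 1 i
tm-no-period-1 i cube with even-or-odd i
... | inj₁ (a , i≡2a) = tm-differs-from-even i a i≡2a
      (trans (cong tm (sym (+-identityʳ i))) (trans (cube 0 (s≤s z≤n)) (cong tm (trans (cong (_+ 1) (+-identityʳ i)) (+-comm i 1)))))
... | inj₂ (a , i≡2a+1) = tm-differs-from-even (suc i) (suc a) (trans (cong suc i≡2a+1) (sym (+-suc (suc a) a)))
      (trans (cong tm (+-comm 1 i)) (trans (cube 1 (s≤s (s≤s z≤n))) (cong tm (trans (+-comm (i + 1) 1) (cong suc (+-comm i 1))))))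

double-+-< : ∀ e j n → e ≤ 1 → j < n → e + (j + j) < n + n
double-+-< e j n e≤1 j<n = begin-strict
  e + (j + j)     ≤⟨ +-monoˡ-≤ (j + j) e≤1 ⟩
  suc (j + j)     <⟨ s≤s (≤-reflexive (sym (+-suc j j))) ⟩
  suc j + suc j   ≤⟨ +-mono-≤ j<n j<n ⟩
  n + n           ∎
  where open ≤-Reasoning

-- A cube of even period h + h at i projects, through tm (2n) = tm n, onto a cube
-- of period h at i', where i + e = 2i' rounds i up to an even number.
tm-halve-cube-at : ∀ h i e i' → e ≤ 1 → i + e ≡ i' + i' → HasCube tm (h + h) i → HasCube tm h i'
tm-halve-cube-at h i e i' e≤1 round cube j' j'<2h = begin
  tm (i' + j')                           ≡⟨ sym (tm-even (i' + j')) ⟩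
  tm ((i' + j') + (i' + j'))             ≡⟨ cong tm (sym position) ⟩
  tm (i + offset)                             ≡⟨ cube offset offset< ⟩
  tm (i + offset + (h + h))                   ≡⟨ cong (λ n → tm (n + (h + h))) position ⟩
  tm ((i' + j') + (i' + j') + (h + h))   ≡⟨ cong tm (+-interchange (i' + j') (i' + j') h h) ⟩
  tm ((i' + j' + h) + (i' + j' + h))     ≡⟨ tm-even (i' + j' + h) ⟩
  tm (i' + j' + h)                       ∎
  where
  open ≡-Reasoning
  offset : ℕ
  offset = e + (j' + j')
  position : i + offset ≡ (i' + j') + (i' + j')
  position = trans (sym (+-assoc i e (j' + j')))
                   (trans (cong (_+ (j' + j')) round) (+-interchange i' i' j' j'))
  offset< : offset < (h + h) + (h + h)
  offset< = double-+-< e j' (h + h) e≤1 j'<2h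

tm-halve-cube : ∀ h i → HasCube tm (h + h) i → ∃[ i' ] HasCube tm h i'
tm-halve-cube h i cube with even-or-odd i
... | inj₁ (a , refl) = a , tm-halve-cube-at h (a + a) 0 a z≤n (+-identityʳ (a + a)) cube
... | inj₂ (a , refl) = suc a , tm-halve-cube-at h (suc (a + a)) 1 (suc a) ≤-refl
                                  (trans (+-comm (suc (a + a)) 1) (cong suc (sym (+-suc a a)))) cube

-- In a cube of odd period q = 2k + 1 the letter changes at every step: at an even
-- position by tm-differs-from-even, at an odd position because q steps later the
-- position is even and the cube repeats both letters.  So such a cube (k ≥ 1, hence
-- of length ≥ 6) contains a cube of period 2.
tm-odd-period-to-2 : ∀ k i → 1 ≤ k → HasCube tm (suc (k + k)) i → HasCube tm 2 i
tm-odd-period-to-2 k i 1≤k cube j j<4 =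
  trans (bool-alternation (changes j (<-trans (n<1+n (suc j)) j+2<2q)) (changes (suc j) j+2<2q))
        (cong tm (step₂ i j))
  where
  q : ℕ
  q = suc (k + k)
  j+2<2q : suc (suc j) < q + q
  j+2<2q = ≤-trans (s≤s (s≤s j<4)) (+-mono-≤ (s≤s (+-mono-≤ 1≤k 1≤k)) (s≤s (+-mono-≤ 1≤k 1≤k)))
  changes : ∀ u → suc u < q + q → tm (i + u) ≢ tm (i + suc u)
  changes u su<2q eq with even-or-odd (i + u)
  ... | inj₁ (a , even) = tm-differs-from-even (i + u) a even (trans eq (cong tm (+-suc i u)))
  ... | inj₂ (a , odd') = tm-differs-from-even (i + u + q) (suc (a + k)) later (begin
        tm (i + u + q)       ≡⟨ sym (cube u (<-trans (n<1+n u) su<2q)) ⟩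
        tm (i + u)           ≡⟨ eq ⟩
        tm (i + suc u)       ≡⟨ cube (suc u) su<2q ⟩
        tm (i + suc u + q)   ≡⟨ cong (λ n → tm (n + q)) (+-suc i u) ⟩
        tm (suc (i + u + q)) ∎)
    where
    open ≡-Reasoning
    later : i + u + q ≡ suc (a + k) + suc (a + k)
    later = trans (cong (_+ q) odd') (odd-sum a k)
      where
      odd-sum : ∀ a k → suc (a + a) + suc (k + k) ≡ suc (a + k) + suc (a + k)
      odd-sum = solve-∀
  step₂ : ∀ i j → i + suc (suc j) ≡ i + j + 2
  step₂ = solve-∀

-- Thue–Morse is cubefree: by strong induction on the period, even periods halve
-- and odd periods ≥ 3 reduce to period 2, leaving only period 1.
tm-no-cube : ∀ p i → 1 ≤ p → ¬ HasCube tm p i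
tm-no-cube = <-rec (λ p → ∀ i → 1 ≤ p → ¬ HasCube tm p i) step
  where
  step : ∀ p → (∀ {q} → q < p → ∀ i → 1 ≤ q → ¬ HasCube tm q i) → ∀ i → 1 ≤ p → ¬ HasCube tm p i
  step p smaller i 1≤p cube with even-or-odd p
  step .0 smaller i () cube | inj₁ (zero , refl)
  step p smaller i 1≤p cube | inj₁ (h@(suc _) , refl) with tm-halve-cube h i cube
  ... | i' , cube' = smaller (m<m+n h (s≤s z≤n)) i' (s≤s z≤n) cube'
  step p smaller i 1≤p cube | inj₂ (zero , refl) = tm-no-period-1 i cube
  step p smaller i 1≤p cube | inj₂ (suc k , refl) =
    smaller {2} (s≤s (s≤s (≤-trans (s≤s z≤n) (m≤n+m (suc k) k)))) i (s≤s z≤n) (tm-odd-period-to-2 (suc k) i (s≤s z≤n) cube)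

quotient-of : ∀ K d n .{{_ : NonZero n}} → d < n → (K * n + d) / n ≡ K
quotient-of K d n d<n = begin
  (K * n + d) / n   ≡⟨ cong (_/ n) (+-comm (K * n) d) ⟩
  (d + K * n) / n   ≡⟨ +-distrib-/ d (K * n) no-carry ⟩
  d / n + K * n / n ≡⟨ cong₂ _+_ (m<n⇒m/n≡0 d<n) (m*n/n≡m K n) ⟩
  K                 ∎
  where
  open ≡-Reasoning
  no-carry : d % n + K * n % n < n
  no-carry = subst (λ r → d % n + r < n) (sym (m*n%n≡0 K n)) (subst (_< n) (sym (+-identityʳ (d % n))) (m%n<n d n))

remainder-of : ∀ K d n .{{_ : NonZero n}} → d < n → (K * n + d) % n ≡ d
remainder-of K d n d<n = trans (cong (_% n) (+-comm (K * n) d)) (trans ([m+kn]%n≡m%n d K n) (m<n⇒m%n≡m d<n))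

divide-by-9 : ∀ i → ∃[ K ] ∃[ o ] (o < 9 × i ≡ K * 9 + o)
divide-by-9 i = i / 9 , i % 9 , m%n<n i 9 , trans (m≡m%n+[m/n]*n i 9) (+-comm (i % 9) (i / 9 * 9))

next-with-offset : ∀ i t → t < 9 → ∃[ K ] ∃[ d ] (d ≤ 8 × i + d ≡ K * 9 + t)
next-with-offset i t t<9 with divide-by-9 i
... | K , o , o<9 , refl with o ≤? t
...   | yes o≤t = K , t ∸ o , ≤-trans (m∸n≤m t o) (≤-pred t<9) ,
                  trans (+-assoc (K * 9) o (t ∸ o)) (cong (K * 9 +_) (m+[n∸m]≡n o≤t))
...   | no o≰t = suc K , (9 ∸ o) + t , ≤-pred d<9 , position
  where
  t<o : t < o
  t<o = ≰⇒> o≰t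
  d<9 : (9 ∸ o) + t < 9
  d<9 = begin-strict
    (9 ∸ o) + t   <⟨ +-monoʳ-< (9 ∸ o) t<o ⟩
    (9 ∸ o) + o   ≡⟨ m∸n+n≡m (<⇒≤ o<9) ⟩
    9             ∎
    where open ≤-Reasoning
  position : K * 9 + o + ((9 ∸ o) + t) ≡ suc K * 9 + t
  position = begin
    K * 9 + o + ((9 ∸ o) + t) ≡⟨ +-assoc (K * 9) o ((9 ∸ o) + t) ⟩
    K * 9 + (o + ((9 ∸ o) + t)) ≡⟨ cong (K * 9 +_) (sym (+-assoc o (9 ∸ o) t)) ⟩
    K * 9 + (o + (9 ∸ o) + t) ≡⟨ cong (λ x → K * 9 + (x + t)) (m+[n∸m]≡n (<⇒≤ o<9)) ⟩
    K * 9 + (9 + t)           ≡⟨ sym (+-assoc (K * 9) 9 t) ⟩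
    K * 9 + 9 + t             ≡⟨ cong (_+ t) (+-comm (K * 9) 9) ⟩
    suc K * 9 + t             ∎
    where open ≡-Reasoning

-- The middle code letter is a itself, and b can be
-- recovered from the code.
block : Bool → Bool → ℕ → Bool
block a b 0 = true
block a b 1 = false
block a b 2 = false
block a b 3 = true
block a b 4 = true
block a b 5 = false
block a b 6 = not (a ∧ b)
block a b 7 = a
block a b 8 = not a ∧ not b
block a b _ = false

header : ℕ → Bool
header = block false false

block-header : ∀ a b c → c < 6 → block a b c ≡ header c
block-header a b 0 _ = refl
block-header a b 1 _ = refl
block-header a b 2 _ = refl
block-header a b 3 _ = refl
block-header a b 4 _ = refl
block-header a b 5 _ = refl
block-header a b (suc (suc (suc (suc (suc (suc c)))))) (s≤s (s≤s (s≤s (s≤s (s≤s (s≤s ()))))))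

decodeFree : Bool → Bool → Bool → Bool
decodeFree x y z = if y then not x else not z

decodeFree-block : ∀ a b → decodeFree (block a b 6) (block a b 7) (block a b 8) ≡ b
decodeFree-block false false = refl
decodeFree-block false true = refl
decodeFree-block true false = refl
decodeFree-block true true = refl

decodeAt : (ℕ → Bool) → ℕ → Bool
decodeAt v p = decodeFree (v (p + 6)) (v (p + 7)) (v (p + 8))

decodeAt-agree : ∀ v v' p → (∀ d → d < 9 → v (p + d) ≡ v' (p + d)) → decodeAt v p ≡ decodeAt v' p
decodeAt-agree v v' p agree
  rewrite agree 6 (m<m+n 6 (s≤s z≤n)) | agree 7 (m<m+n 7 (s≤s z≤n)) | agree 8 (m<m+n 8 (s≤s z≤n)) = refl

decodeAt-block : ∀ v p a b → (∀ d → d < 9 → v (p + d) ≡ block a b d) → decodeAt v p ≡ b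
decodeAt-block v p a b isBlock
  rewrite isBlock 6 (m<m+n 6 (s≤s z≤n)) | isBlock 7 (m<m+n 7 (s≤s z≤n)) | isBlock 8 (m<m+n 8 (s≤s z≤n)) =
  decodeFree-block a b

blockWord : (ℕ → Bool) → InfWord
blockWord f n = block (tm (n / 9)) (f (n / 9)) (n % 9)

blockWord-at : ∀ f K d → d < 9 → blockWord f (K * 9 + d) ≡ block (tm K) (f K) d
blockWord-at f K d d<9 rewrite quotient-of K d 9 d<9 | remainder-of K d 9 d<9 = refl

pickBlock : Bool → Bool → Bool → Bool → Bool → Bool → ℕ → ℕ → Bool
pickBlock a0 b0 a1 b1 a2 b2 0 = block a0 b0
pickBlock a0 b0 a1 b1 a2 b2 1 = block a1 b1
pickBlock a0 b0 a1 b1 a2 b2 _ = block a2 b2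

window : Bool → Bool → Bool → Bool → Bool → Bool → ℕ → Bool
window a0 b0 a1 b1 a2 b2 n = pickBlock a0 b0 a1 b1 a2 b2 (n / 9) (n % 9)

windowAt : (ℕ → Bool) → ℕ → ℕ → Bool
windowAt f K = window (tm K) (f K) (tm (K + 1)) (f (K + 1)) (tm (K + 2)) (f (K + 2))

pickBlock-at : ∀ (f : ℕ → Bool) K c → c < 3 →
  block (tm (K + c)) (f (K + c)) ≡ pickBlock (tm K) (f K) (tm (K + 1)) (f (K + 1)) (tm (K + 2)) (f (K + 2)) c
pickBlock-at f K 0 _ rewrite +-identityʳ K = refl
pickBlock-at f K 1 _ = refl
pickBlock-at f K 2 _ = refl
pickBlock-at f K (suc (suc (suc c))) (s≤s (s≤s (s≤s ())))

blockWord-window : ∀ f K n → n < 27 → blockWord f (K * 9 + n) ≡ windowAt f K n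
blockWord-window f K n n<27 with divide-by-9 n
... | c , d , d<9 , refl = begin
  blockWord f (K * 9 + (c * 9 + d))  ≡⟨ cong (blockWord f) (regroup K c d) ⟩
  blockWord f ((K + c) * 9 + d)      ≡⟨ blockWord-at f (K + c) d d<9 ⟩
  block (tm (K + c)) (f (K + c)) d   ≡⟨ cong (λ g → g d) (pickBlock-at f K c c<3) ⟩
  pick c d                           ≡⟨ sym (cong₂ pick (quotient-of c d 9 d<9) (remainder-of c d 9 d<9)) ⟩
  windowAt f K (c * 9 + d)           ∎
  where
  open ≡-Reasoning
  pick : ℕ → ℕ → Bool
  pick = pickBlock (tm K) (f K) (tm (K + 1)) (f (K + 1)) (tm (K + 2)) (f (K + 2))
  regroup : ∀ K c d → K * 9 + (c * 9 + d) ≡ (K + c) * 9 + d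
  regroup = solve-∀
  c<3 : c < 3
  c<3 = *-cancelʳ-< 9 c 3 (≤-<-trans (m≤m+n (c * 9) d) n<27)

allBelow : ℕ → (ℕ → Bool) → Bool
allBelow zero g = true
allBelow (suc n) g = allBelow n g ∧ g n

anyBelow : ℕ → (ℕ → Bool) → Bool
anyBelow zero g = false
anyBelow (suc n) g = anyBelow n g ∨ g n

allBool : (Bool → Bool) → Bool
allBool g = g false ∧ g true

allBelow-sound : ∀ n g → T (allBelow n g) → ∀ x → x < n → T (g x)
allBelow-sound (suc n) g all x x<1+n with Equivalence.to T-∧ all | m<1+n⇒m<n∨m≡n x<1+n
... | below , _ | inj₁ x<n = allBelow-sound n g below x x<n
... | _ , last | inj₂ refl = last

anyBelow-sound : ∀ n g → T (anyBelow n g) → ∃[ x ] (x < n × T (g x))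
anyBelow-sound (suc n) g any with Equivalence.to T-∨ any
... | inj₁ below with anyBelow-sound n g below
...   | x , x<n , gx = x , m<n⇒m<1+n x<n , gx
anyBelow-sound (suc n) g any | inj₂ last = n , ≤-refl , last

allBool-sound : ∀ g → T (allBool g) → ∀ b → T (g b)
allBool-sound g all false = proj₁ (Equivalence.to T-∧ all)
allBool-sound g all true = proj₂ (Equivalence.to T-∧ all)

T-xor-≢ : ∀ x y → T (x xor y) → x ≢ y
T-xor-≢ false false () _
T-xor-≢ true true () _

-- The two local properties of the block word, checked on all 64 windows:
-- no cube of period 1 to 6 starts in the first block of a window, and the header
-- does not occur at offsets 1 to 8 of a window.
noShortCube : (ℕ → Bool) → Bool
noShortCube v = allBelow 9 λ o → allBelow 6 λ p' →
                  anyBelow (suc p' + suc p') λ j → v (o + j) xor v (o + j + suc p')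

noMisplacedHeader : (ℕ → Bool) → Bool
noMisplacedHeader v = allBelow 8 λ o' → anyBelow 6 λ c → v (suc o' + c) xor header c

noShortCube-sound : ∀ v → T (noShortCube v) → ∀ o p' → o < 9 → p' < 6 →
                    ∃[ j ] (j < suc p' + suc p' × v (o + j) ≢ v (o + j + suc p'))
noShortCube-sound v ok o p' o<9 p'<6
  with anyBelow-sound (suc p' + suc p') (λ j → v (o + j) xor v (o + j + suc p'))
         (allBelow-sound 6 (λ p' → anyBelow (suc p' + suc p') λ j → v (o + j) xor v (o + j + suc p'))
           (allBelow-sound 9 (λ o → allBelow 6 λ p' → anyBelow (suc p' + suc p') λ j → v (o + j) xor v (o + j + suc p'))
             ok o o<9) p' p'<6)
... | j , j<2p , differs = j , j<2p , T-xor-≢ _ _ differs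

noMisplacedHeader-sound : ∀ v → T (noMisplacedHeader v) → ∀ o' → o' < 8 → ∃[ c ] (c < 6 × v (suc o' + c) ≢ header c)
noMisplacedHeader-sound v ok o' o'<8
  with anyBelow-sound 6 (λ c → v (suc o' + c) xor header c)
         (allBelow-sound 8 (λ o' → anyBelow 6 λ c → v (suc o' + c) xor header c) ok o' o'<8)
... | c , c<6 , differs = c , c<6 , T-xor-≢ _ _ differs

-- A window is determined by six Booleans, so a check on all windows is a finite
-- computation; its outcome applies to every window of every block word.
forEveryWindow : ((ℕ → Bool) → Bool) → Bool
forEveryWindow check =
  allBool λ a0 → allBool λ b0 → allBool λ a1 → allBool λ b1 → allBool λ a2 → allBool λ b2 →
  check (window a0 b0 a1 b1 a2 b2)

forEveryWindow-sound : ∀ check → T (forEveryWindow check) → ∀ f K → T (check (windowAt f K))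
forEveryWindow-sound check all f K =
  allBool-sound (λ b2 → check (window a0 b0 a1 b1 a2 b2))
  (allBool-sound (λ a2 → allBool λ b2 → check (window a0 b0 a1 b1 a2 b2))
  (allBool-sound (λ b1 → allBool λ a2 → allBool λ b2 → check (window a0 b0 a1 b1 a2 b2))
  (allBool-sound (λ a1 → allBool λ b1 → allBool λ a2 → allBool λ b2 → check (window a0 b0 a1 b1 a2 b2))
  (allBool-sound (λ b0 → allBool λ a1 → allBool λ b1 → allBool λ a2 → allBool λ b2 → check (window a0 b0 a1 b1 a2 b2))
  (allBool-sound (λ a0 → allBool λ b0 → allBool λ a1 → allBool λ b1 → allBool λ a2 → allBool λ b2 → check (window a0 b0 a1 b1 a2 b2))
   all a0) b0) a1) b1) a2) b2
  where
  a0 b0 a1 b1 a2 b2 : Bool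
  a0 = tm K
  b0 = f K
  a1 = tm (K + 1)
  b1 = f (K + 1)
  a2 = tm (K + 2)
  b2 = f (K + 2)

windows-noShortCube : ∀ f K → T (noShortCube (windowAt f K))
windows-noShortCube = forEveryWindow-sound noShortCube tt

windows-noMisplacedHeader : ∀ f K → T (noMisplacedHeader (windowAt f K))
windows-noMisplacedHeader = forEveryWindow-sound noMisplacedHeader tt

within-blocks : ∀ d j q → d ≤ 8 → j < q + q → d + j * 9 < q * 9 + q * 9
within-blocks d j q d≤8 j<2q = begin-strict
  d + j * 9       ≤⟨ +-monoˡ-≤ (j * 9) d≤8 ⟩
  8 + j * 9       <⟨ ≤-refl ⟩
  suc j * 9       ≤⟨ *-monoˡ-≤ 9 j<2q ⟩
  (q + q) * 9     ≡⟨ *-distribʳ-+ 9 q q ⟩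
  q * 9 + q * 9   ∎
  where open ≤-Reasoning

module _ (f : ℕ → Bool) where

  -- A cube of period at most 6 would give a short cube starting in the first block of
  -- some window, which the exhaustive check rules out.
  blockWord-no-short-cube : ∀ p i → 1 ≤ p → p ≤ 6 → ¬ HasCube (blockWord f) p i
  blockWord-no-short-cube (suc p') i _ p≤6 cube with divide-by-9 i
  ... | K , o , o<9 , refl = differs (begin
    windowAt f K (o + j)                   ≡⟨ sym (blockWord-window f K (o + j) (≤-<-trans (m≤m+n (o + j) (suc p')) inWindow)) ⟩
    blockWord f (K * 9 + (o + j))          ≡⟨ cong (blockWord f) (sym (+-assoc (K * 9) o j)) ⟩
    blockWord f (K * 9 + o + j)            ≡⟨ cube j j<2p ⟩
    blockWord f (K * 9 + o + j + suc p')   ≡⟨ cong (blockWord f) (regroup (K * 9) o j (suc p')) ⟩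
    blockWord f (K * 9 + (o + j + suc p')) ≡⟨ blockWord-window f K (o + j + suc p') inWindow ⟩
    windowAt f K (o + j + suc p')          ∎)
    where
    open ≡-Reasoning
    witness : ∃[ j ] (j < suc p' + suc p' × windowAt f K (o + j) ≢ windowAt f K (o + j + suc p'))
    witness = noShortCube-sound (windowAt f K) (windows-noShortCube f K) o p' o<9 p≤6
    j : ℕ
    j = proj₁ witness
    j<2p : j < suc p' + suc p'
    j<2p = proj₁ (proj₂ witness)
    differs : windowAt f K (o + j) ≢ windowAt f K (o + j + suc p')
    differs = proj₂ (proj₂ witness)
    regroup : ∀ a o j p → a + o + j + p ≡ a + (o + j + p)
    regroup = solve-∀
    inWindow : o + j + suc p' < 27
    inWindow = s≤s (≤-trans (+-mono-≤ (+-mono-≤ (≤-pred o<9) (≤-pred (≤-trans j<2p (+-mono-≤ p≤6 p≤6)))) p≤6) (n≤1+n 25))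

  header-position : ∀ n → (∀ c → c < 6 → blockWord f (n + c) ≡ header c) → 9 ∣ n
  header-position n isHeader with divide-by-9 n
  ... | K , zero , _ , refl = divides K (+-identityʳ (K * 9))
  ... | K , suc o' , o<9 , refl = ⊥-elim (differs (begin
    windowAt f K (suc o' + c)           ≡⟨ sym (blockWord-window f K (suc o' + c) inWindow) ⟩
    blockWord f (K * 9 + (suc o' + c))  ≡⟨ cong (blockWord f) (sym (+-assoc (K * 9) (suc o') c)) ⟩
    blockWord f (K * 9 + suc o' + c)    ≡⟨ isHeader c c<6 ⟩
    header c                            ∎))
    where
    open ≡-Reasoning
    witness : ∃[ c ] (c < 6 × windowAt f K (suc o' + c) ≢ header c)
    witness = noMisplacedHeader-sound (windowAt f K) (windows-noMisplacedHeader f K) o' (≤-pred o<9)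
    c : ℕ
    c = proj₁ witness
    c<6 : c < 6
    c<6 = proj₁ (proj₂ witness)
    differs : windowAt f K (suc o' + c) ≢ header c
    differs = proj₂ (proj₂ witness)
    inWindow : suc o' + c < 27
    inWindow = s≤s (≤-trans (+-mono-≤ (≤-pred o<9) (≤-pred c<6)) (m≤m+n 13 13))

  -- A cube of period p ≥ 7 contains the header of the first block starting inside it,
  -- and repeats it p letters later; so p is a multiple of 9.
  long-cube-period : ∀ p i → 7 ≤ p → HasCube (blockWord f) p i → 9 ∣ p
  long-cube-period p i 7≤p cube with next-with-offset i 0 (s≤s z≤n)
  ... | K , d , d≤8 , i+d≡B = ∣m+n∣m⇒∣n (header-position (B + p) repeated) (divides K (+-identityʳ (K * 9)))
    where
    B : ℕ
    B = K * 9 + 0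
    repeated : ∀ c → c < 6 → blockWord f (B + p + c) ≡ header c
    repeated c c<6 = begin
      blockWord f (B + p + c)         ≡⟨ cong (blockWord f) (sym later) ⟩
      blockWord f (i + (d + c) + p)   ≡⟨ sym (cube (d + c) (≤-trans (s≤s (+-mono-≤ d≤8 (≤-pred c<6))) (+-mono-≤ 7≤p 7≤p))) ⟩
      blockWord f (i + (d + c))       ≡⟨ cong (blockWord f) now ⟩
      blockWord f (K * 9 + c)         ≡⟨ blockWord-at f K c (≤-trans c<6 (m≤m+n 6 3)) ⟩
      block (tm K) (f K) c            ≡⟨ block-header (tm K) (f K) c c<6 ⟩
      header c                        ∎
      where
      open ≡-Reasoning
      now : i + (d + c) ≡ K * 9 + c
      now = trans (sym (+-assoc i d c)) (trans (cong (_+ c) i+d≡B) (cong (_+ c) (+-identityʳ (K * 9))))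
      later : i + (d + c) + p ≡ B + p + c
      later = trans (cong (_+ p) (trans (sym (+-assoc i d c)) (cong (_+ c) i+d≡B))) (xy∙z≈xz∙y B c p)

  -- A cube of period 9q restricts, at offset 7 of every block, to a cube of period q
  -- of the Thue–Morse word.
  aligned-cube : ∀ q i → HasCube (blockWord f) (q * 9) i → ∃[ k ] HasCube tm q k
  aligned-cube q i cube with next-with-offset i 7 (m<m+n 7 (s≤s z≤n))
  ... | K , d , d≤8 , i+d≡ = K , restricted
    where
    restricted : HasCube tm q K
    restricted j' j'<2q = begin
      tm (K + j')                         ≡⟨ sym (blockWord-at f (K + j') 7 7<9) ⟩
      blockWord f ((K + j') * 9 + 7)      ≡⟨ cong (blockWord f) (sym now) ⟩
      blockWord f (i + offset)            ≡⟨ cube offset offset<18q ⟩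
      blockWord f (i + offset + q * 9)    ≡⟨ cong (blockWord f) later ⟩
      blockWord f ((K + j' + q) * 9 + 7)  ≡⟨ blockWord-at f (K + j' + q) 7 7<9 ⟩
      tm (K + j' + q)                     ∎
      where
      open ≡-Reasoning
      7<9 : 7 < 9
      7<9 = m<m+n 7 (s≤s z≤n)
      offset : ℕ
      offset = d + j' * 9
      now : i + offset ≡ (K + j') * 9 + 7
      now = trans (sym (+-assoc i d (j' * 9))) (trans (cong (_+ j' * 9) i+d≡) (regroup K j'))
        where
        regroup : ∀ K j → K * 9 + 7 + j * 9 ≡ (K + j) * 9 + 7
        regroup = solve-∀
      later : i + offset + q * 9 ≡ (K + j' + q) * 9 + 7
      later = trans (cong (_+ q * 9) now) (regroup K j' q)
        where
        regroup : ∀ K j q → (K + j) * 9 + 7 + q * 9 ≡ (K + j + q) * 9 + 7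
        regroup = solve-∀
      offset<18q : offset < q * 9 + q * 9
      offset<18q = within-blocks d j' q d≤8 j'<2q

  blockWord-no-cube : ∀ p i → 1 ≤ p → ¬ HasCube (blockWord f) p i
  blockWord-no-cube p i 1≤p cube with p ≤? 6
  ... | yes p≤6 = blockWord-no-short-cube p i 1≤p p≤6 cube
  ... | no p≰6 = no-aligned-cube (long-cube-period p i (≰⇒> p≰6) cube)
    where
    no-aligned-cube : 9 ∣ p → ⊥
    no-aligned-cube (divides zero p≡0) = <⇒≱ 1≤p (≤-reflexive p≡0)
    no-aligned-cube (divides (suc q) p≡q*9) =
      tm-no-cube (suc q) (proj₁ restricted) (s≤s z≤n) (proj₂ restricted)
      where
      restricted : ∃[ k ] HasCube tm (suc q) k
      restricted = aligned-cube (suc q) i (subst (λ p → HasCube (blockWord f) p i) p≡q*9 cube)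

  blockWord-cubeFree : CubeFree (blockWord f)
  blockWord-cubeFree = cubeFree-from-periods (blockWord f) blockWord-no-cube

-- The selector.  It reads a level m from the iterated logarithm of K and returns the
-- binary digit number (K mod 2 ^ m) of ⌊K / 2 ^ (m + 2)⌋.
selectAt : ℕ → ℕ → Bool
selectAt m K = bit (lowBits m K) (shiftR (2 + m) K)

select : ℕ → Bool
select K = selectAt (⌊log₂ ⌊log₂ K ⌋ ⌋ ∸ 1) K

n<2^n : ∀ n → n < 2 ^ n
n<2^n zero = s≤s z≤n
n<2^n (suc n) = begin-strict
  suc n           <⟨ +-mono-≤ (m^n>0 2 n) (n<2^n n) ⟩
  2 ^ n + 2 ^ n   ≡⟨ cong (2 ^ n +_) (sym (+-identityʳ (2 ^ n))) ⟩
  2 ^ suc n       ∎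
  where open ≤-Reasoning

2+m<2^[1+m] : ∀ m → 1 ≤ m → 2 + m < 2 ^ suc m
2+m<2^[1+m] (suc zero) _ = s≤s (s≤s (s≤s (s≤s z≤n)))
2+m<2^[1+m] (suc (suc m)) _ = begin-strict
  3 + suc m                   <⟨ s≤s (2+m<2^[1+m] (suc m) (s≤s z≤n)) ⟩
  1 + 2 ^ suc (suc m)         ≤⟨ +-monoˡ-≤ (2 ^ suc (suc m)) (m^n>0 2 (suc (suc m))) ⟩
  2 ^ suc (suc m) + 2 ^ suc (suc m)   ≡⟨ cong (2 ^ suc (suc m) +_) (sym (+-identityʳ _)) ⟩
  2 ^ suc (suc (suc m))       ∎
  where open ≤-Reasoning

concat-< : ∀ a b x y → y < 2 ^ a → x < 2 ^ b → 2 ^ a * x + y < 2 ^ (b + a)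
concat-< a b x y y< x< = begin-strict
  2 ^ a * x + y       <⟨ +-monoʳ-< (2 ^ a * x) y< ⟩
  2 ^ a * x + 2 ^ a   ≡⟨ trans (+-comm (2 ^ a * x) (2 ^ a)) (sym (*-suc (2 ^ a) x)) ⟩
  2 ^ a * suc x       ≤⟨ *-monoʳ-≤ (2 ^ a) x< ⟩
  2 ^ a * 2 ^ b       ≡⟨ trans (*-comm (2 ^ a) (2 ^ b)) (sym (^-distribˡ-+-* 2 b a)) ⟩
  2 ^ (b + a)         ∎
  where open ≤-Reasoning

log-2^E+y : ∀ E y → y < 2 ^ E → ⌊log₂ (2 ^ E + y) ⌋ ≡ E
log-2^E+y E y y< = log-from-shiftR E (2 ^ E + y)
  (trans (cong (λ t → shiftR E (t + y)) (sym (*-identityʳ (2 ^ E)))) (shiftR-split E 1 y y<))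

low-part-< : ∀ m c r → c ≤ 2 → r < 2 ^ m → 2 ^ m * c + r < 2 ^ (2 + m)
low-part-< m c r c≤2 r< = begin-strict
  P * c + r           <⟨ +-monoʳ-< (P * c) r< ⟩
  P * c + P           ≤⟨ +-monoˡ-≤ P (*-monoʳ-≤ P c≤2) ⟩
  P * 2 + P           ≤⟨ m≤m+n (P * 2 + P) P ⟩
  P * 2 + P + P       ≡⟨ regroup P ⟩
  2 * (2 * P)         ∎
  where
  open ≤-Reasoning
  P : ℕ
  P = 2 ^ m
  regroup : ∀ P → P * 2 + P + P ≡ 2 * (2 * P)
  regroup = solve-∀

-- The blocks the squares are built from: for x < 2 ^ 2 ^ m, c ≤ 2 and r < 2 ^ m, the
-- block index K = 2 ^ m (4 I + c) + r with I = 2 ^ 2 ^ (m + 1) + x has binary logarithm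
-- E = 2 ^ (m + 1) + (m + 2), and E has binary logarithm m + 1.  So the selector reads
-- off the level m, the digit r and I, whose digit r is that of x.
select-reads : ∀ m x c r → 1 ≤ m → x < 2 ^ 2 ^ m → c ≤ 2 → r < 2 ^ m →
  select (2 ^ m * (4 * (2 ^ 2 ^ suc m + x) + c) + r) ≡ bit r x
select-reads m x c r 1≤m x< c≤2 r< = begin
  select K                              ≡⟨ cong (λ l → selectAt (l ∸ 1) K) (trans (cong ⌊log₂_⌋ log-K) log-E) ⟩
  bit (lowBits m K) (shiftR (2 + m) K)  ≡⟨ cong₂ bit (lowBits-split m (4 * I + c) r r<) high-part ⟩
  bit r I                               ≡⟨ bit-add-high r S x (<-≤-trans r< (^-monoʳ-≤ 2 (n≤1+n m))) ⟩
  bit r x                               ∎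
  where
  open ≡-Reasoning
  S I A E low K : ℕ
  S = 2 ^ suc m
  I = 2 ^ S + x
  A = 2 ^ (2 + m)
  E = S + (2 + m)
  low = 2 ^ m * c + r
  K = 2 ^ m * (4 * I + c) + r
  K-as-A : K ≡ A * I + low
  K-as-A = regroup (2 ^ m) I c r
    where
    regroup : ∀ P I c r → P * (4 * I + c) + r ≡ 2 * (2 * P) * I + (P * c + r)
    regroup = solve-∀
  high-part : shiftR (2 + m) K ≡ I
  high-part = trans (cong (shiftR (2 + m)) K-as-A) (shiftR-split (2 + m) I low (low-part-< m c r c≤2 r<))
  K-as-E : K ≡ 2 ^ E + (A * x + low)
  K-as-E = trans K-as-A (trans (regroup A (2 ^ S) x low) (cong (_+ (A * x + low)) (sym (^-distribˡ-+-* 2 S (2 + m)))))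
    where
    regroup : ∀ A B x y → A * (B + x) + y ≡ B * A + (A * x + y)
    regroup = solve-∀
  log-K : ⌊log₂ K ⌋ ≡ E
  log-K = trans (cong ⌊log₂_⌋ K-as-E)
                (log-2^E+y E (A * x + low) (concat-< (2 + m) S x low (low-part-< m c r c≤2 r<)
                                             (<-≤-trans x< (^-monoʳ-≤ 2 (^-monoʳ-≤ 2 (n≤1+n m))))))
  log-E : ⌊log₂ E ⌋ ≡ suc m
  log-E = log-2^E+y (suc m) (2 + m) (2+m<2^[1+m] m 1≤m)

*-^-distrib : ∀ a b k → (a * b) ^ k ≡ a ^ k * b ^ k
*-^-distrib a b zero = refl
*-^-distrib a b (suc k) rewrite *-^-distrib a b k = *-interchange a b (a ^ k) (b ^ k)

-- Exponential growth: (27 / 26) ^ 18 ≤ 2, hence 27 ^ (18 k) ≤ 2 ^ k · 26 ^ (18 k).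
growth : ∀ k → 27 ^ (18 * k) ≤ 2 ^ k * 26 ^ (18 * k)
growth k = begin
  27 ^ (18 * k)           ≡⟨ sym (^-*-assoc 27 18 k) ⟩
  (27 ^ 18) ^ k           ≤⟨ ^-monoˡ-≤ k (toWitness {a? = 27 ^ 18 ≤? 2 * 26 ^ 18} tt) ⟩
  (2 * 26 ^ 18) ^ k       ≡⟨ *-^-distrib 2 (26 ^ 18) k ⟩
  2 ^ k * (26 ^ 18) ^ k   ≡⟨ cong (2 ^ k *_) (^-*-assoc 26 18 k) ⟩
  2 ^ k * 26 ^ (18 * k)   ∎
  where open ≤-Reasoning

word : InfWord
word = blockWord select

-- At level m ≥ 1 the word contains 2 ^ 2 ^ m distinct squares of length 18 · 2 ^ m: for
-- x < 2 ^ 2 ^ m and I = 2 ^ 2 ^ (m + 1) + x, the 2 · 2 ^ m blocks from 2 ^ m (4 I + 1) on.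
-- Blocks 2 ^ m (4 I + 1) + r and 2 ^ m (4 I + 2) + r agree (same Thue–Morse letter by
-- tm-twin, same selected letter bit r x), and the selected letters spell out x.
module SquareFamily (m : ℕ) (1≤m : 1 ≤ m) where

  count : ℕ
  count = 2 ^ 2 ^ m

  I : ℕ → ℕ
  I x = 2 ^ 2 ^ suc m + x

  half : ℕ
  half = 2 ^ m * 9

  squareLength : ℕ
  squareLength = half + half

  firstBlock : ℕ → ℕ → ℕ
  firstBlock x r = 2 ^ m * (4 * I x + 1) + r

  secondBlock : ℕ → ℕ → ℕ
  secondBlock x r = 2 ^ m * (4 * I x + 2) + r

  start : ℕ → ℕ
  start x = 2 ^ m * (4 * I x + 1) * 9

  square : ℕ → Word
  square x = factorAt word (start x) squareLength

  letter-first : ∀ x r d → d < 9 →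
    word (start x + (r * 9 + d)) ≡ block (tm (firstBlock x r)) (select (firstBlock x r)) d
  letter-first x r d d<9 = trans (cong word (regroup (2 ^ m) (I x) r d)) (blockWord-at select (firstBlock x r) d d<9)
    where
    regroup : ∀ P I r d → P * (4 * I + 1) * 9 + (r * 9 + d) ≡ (P * (4 * I + 1) + r) * 9 + d
    regroup = solve-∀

  letter-second : ∀ x r d → d < 9 →
    word (start x + r * 9 + d + half) ≡ block (tm (secondBlock x r)) (select (secondBlock x r)) d
  letter-second x r d d<9 = trans (cong word (regroup (2 ^ m) (I x) r d)) (blockWord-at select (secondBlock x r) d d<9)
    where
    regroup : ∀ P I r d → P * (4 * I + 1) * 9 + r * 9 + d + P * 9 ≡ (P * (4 * I + 2) + r) * 9 + d
    regroup = solve-∀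

  block-of : ∀ r d → r * 9 + d < half → r < 2 ^ m
  block-of r d r9+d< = *-cancelʳ-< 9 r (2 ^ m) (≤-<-trans (m≤m+n (r * 9) d) r9+d<)

  halves-agree : ∀ x → x < count → Periodic word half (start x) half
  halves-agree x x< j j<half with divide-by-9 j
  ... | r , d , d<9 , refl = begin
    word (start x + (r * 9 + d))  ≡⟨ letter-first x r d d<9 ⟩
    block (tm (firstBlock x r)) (select (firstBlock x r)) d
      ≡⟨ cong₂ (λ a b → block a b d) (tm-twin m (I x) r r<)
               (trans (select-reads m x 1 r 1≤m x< (s≤s z≤n) r<) (sym (select-reads m x 2 r 1≤m x< ≤-refl r<))) ⟩
    block (tm (secondBlock x r)) (select (secondBlock x r)) d
      ≡⟨ sym (letter-second x r d d<9) ⟩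
    word (start x + r * 9 + d + half) ≡⟨ cong (λ p → word (p + half)) (+-assoc (start x) (r * 9) d) ⟩
    word (start x + (r * 9 + d) + half) ∎
    where
    open ≡-Reasoning
    r< : r < 2 ^ m
    r< = block-of r d j<half

  1≤half : 1 ≤ half
  1≤half = *-mono-≤ (m^n>0 2 m) (s≤s z≤n)

  is-square : ∀ x → x < count → IsSquare (square x)
  is-square x x< = periodic-square word half (start x) 1≤half (halves-agree x x<)

  reads-digit : ∀ x r → x < count → r < 2 ^ m → decodeAt (λ j → word (start x + j)) (r * 9) ≡ bit r x
  reads-digit x r x< r< =
    trans (decodeAt-block (λ j → word (start x + j)) (r * 9) (tm (firstBlock x r)) (select (firstBlock x r))
                          (letter-first x r))
          (select-reads m x 1 r 1≤m x< (s≤s z≤n) r<)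

  block-in-square : ∀ r d → r < 2 ^ m → d < 9 → r * 9 + d < squareLength
  block-in-square r d r< d<9 = begin-strict
    r * 9 + d       <⟨ +-monoʳ-< (r * 9) d<9 ⟩
    r * 9 + 9       ≡⟨ +-comm (r * 9) 9 ⟩
    suc r * 9       ≤⟨ *-monoˡ-≤ 9 r< ⟩
    half            ≤⟨ m≤m+n half half ⟩
    squareLength    ∎
    where open ≤-Reasoning

  -- Distinct x give distinct squares, since their code letters spell out x.
  squares-distinct : ∀ x y → x < count → y < count → square x ≡ square y → x ≡ y
  squares-distinct x y x< y< same = bits-injective (2 ^ m) x y x< y< same-digits
    where
    same-digits : ∀ r → r < 2 ^ m → bit r x ≡ bit r y
    same-digits r r< = begin
      bit r x
        ≡⟨ sym (reads-digit x r x< r<) ⟩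
      decodeAt (λ j → word (start x + j)) (r * 9)
        ≡⟨ decodeAt-agree (λ j → word (start x + j)) (λ j → word (start y + j)) (r * 9)
             (λ d d<9 → factorAt-pointwise word (start x) (start y) squareLength same
                          (r * 9 + d) (block-in-square r d r< d<9)) ⟩
      decodeAt (λ j → word (start y + j)) (r * 9)
        ≡⟨ reads-digit y r y< r< ⟩
      bit r y ∎
      where open ≡-Reasoning

  family : List Word
  family = applyUpTo square count

  family-valid : SquareFactorsOfLength word squareLength family
  family-valid = unique-applyUpTo square count distinct , all-applyUpTo square count valid
    where
    distinct : ∀ {x y} → x < y → y < count → square x ≢ square y
    distinct x<y y< same = <⇒≢ x<y (squares-distinct _ _ (<-trans x<y y<) y< same)
    valid : ∀ {x} → x < count → length (square x) ≡ squareLength × IsSquare (square x) × IsFactor word (square x)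
    valid {x} x< = length-factorAt word (start x) squareLength , is-square x x<
                 , start x , cong (factorAt word (start x)) (length-factorAt word (start x) squareLength)

  squareLength≡18·2^m : squareLength ≡ 18 * 2 ^ m
  squareLength≡18·2^m = regroup (2 ^ m)
    where
    regroup : ∀ P → P * 9 + P * 9 ≡ 18 * P
    regroup = solve-∀

  exponential : 27 ^ squareLength ≤ length family * 26 ^ squareLength
  exponential = begin
    27 ^ squareLength                    ≡⟨ cong (27 ^_) squareLength≡18·2^m ⟩
    27 ^ (18 * 2 ^ m)                    ≤⟨ growth (2 ^ m) ⟩
    count * 26 ^ (18 * 2 ^ m)            ≡⟨ cong₂ (λ k l → k * 26 ^ l) (sym (length-applyUpTo square count))
                                                                     (sym squareLength≡18·2^m) ⟩
    length family * 26 ^ squareLength    ∎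
    where open ≤-Reasoning

  level<length : m < squareLength
  level<length = <-≤-trans (n<2^n m) (≤-trans (m≤m*n (2 ^ m) 9) (m≤m+n half half))

theorem2 : ∃[ w ] (CubeFree w × ∃[ p ] ∃[ q ] (1 ≤ q × q < p × (∀ m → ∃[ n ] (m ≤ n × 1 ≤ n × ∃[ L ] (SquareFactorsOfLength w n L × p ^ n ≤ length L * q ^ n)))))
theorem2 = word , blockWord-cubeFree select , 27 , 26 , s≤s z≤n , ≤-refl , squaresOfLengthAbove
  where
  squaresOfLengthAbove :
    ∀ M → ∃[ n ] (M ≤ n × 1 ≤ n × ∃[ L ] (SquareFactorsOfLength word n L × 27 ^ n ≤ length L * 26 ^ n))
  squaresOfLengthAbove M =
    squareLength , ≤-trans (n≤1+n M) (<⇒≤ level<length) , ≤-trans (s≤s z≤n) (<⇒≤ level<length) ,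
    family , family-valid , exponential
    where open SquareFamily (suc M) (s≤s z≤n)
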